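{- Let $p$ be the partially ordered pattern of length $5$ on the labels $\{1,2,3,4,5\}$ whose only relations are $1>2$, $1>3$, $1>4$, $1>5$. Let $a(n)$ be the number of $n$-permutations avoiding $p$. Then $$a(n)=\begin{cases} n! & \text{if } n<5,\\ 6\cdot 4^{n-3} & \text{if } n\geq 5,\end{cases}\qquad \sum_{n\geq 0}a(n)x^n=\frac{1-3x-2x^2-2x^3}{1-4x}.$$
   Context: An $n$-permutation is a permutation $\pi=\pi_1\cdots\pi_n$ of $\{1,\dots,n\}$ written in one-line notation (for $n=0$ there is exactly one, the empty permutation). A partially ordered pattern (POP) $p$ of length $k$ is a partial order $<_P$ on the label set $\{1,\dots,k\}$. An occurrence of $p$ in $\pi$ is a subsequence $\pi_{i_1}\pi_{i_2}\cdots\pi_{i_k}$ with $1\leq i_1<\cdots<i_k\leq n$ such that $\pi_{i_j}<\pi_{i_m}$ whenever $j<_P m$ (no condition is imposed on pairs of incomparable labels). A permutation avoids $p$ if it contains no occurrence of $p$. -}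

module Defs where

open import Data.Nat using (ℕ; zero; suc; _<_; _*_; _^_; _∸_; _!)
open import Data.Fin as F using (Fin)
open import Data.Vec using (Vec; lookup)
open import Data.List using (List; length)
open import Data.List.Membership.Propositional using (_∈_)
open import Data.List.Relation.Unary.Unique.Propositional using (Unique)
open import Data.Product using (Σ; ∃; _×_)
open import Relation.Nullary using (¬_)
open import Function.Definitions using (Injective)
open import Relation.Binary.PropositionalEquality using (_≡_)
open import Data.Integer as ℤ using (ℤ; +_; -[1+_])

-- An n-permutation in one-line notation: a vector π₁…πₙ with entries in Fin n
-- (values 0..n-1 instead of 1..n; irrelevant for patterns) that are pairwise distinct.
-- An injective map Fin n → Fin n is a bijection, so these are exactly the permutations.
IsPerm : (n : ℕ) → Vec (Fin n) n → Set
IsPerm n π = Injective _≡_ _≡_ (lookup π)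

Occurrence : {n : ℕ} → Vec (Fin n) n → Fin n → Fin n → Fin n → Fin n → Fin n → Set
Occurrence π i₁ i₂ i₃ i₄ i₅ =
  (i₁ F.< i₂) × (i₂ F.< i₃) × (i₃ F.< i₄) × (i₄ F.< i₅) ×
  (lookup π i₂ F.< lookup π i₁) × (lookup π i₃ F.< lookup π i₁) ×
  (lookup π i₄ F.< lookup π i₁) × (lookup π i₅ F.< lookup π i₁)

Avoids : {n : ℕ} → Vec (Fin n) n → Set
Avoids π = ¬ (∃ λ i₁ → ∃ λ i₂ → ∃ λ i₃ → ∃ λ i₄ → ∃ λ i₅ → Occurrence π i₁ i₂ i₃ i₄ i₅)

AvoidersCount : ℕ → ℕ → Set
AvoidersCount n m =
  Σ (List (Vec (Fin n) n)) λ L →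
    Unique L ×
    (∀ π → π ∈ L → IsPerm n π × Avoids π) ×
    (∀ π → IsPerm n π → Avoids π → π ∈ L) ×
    length L ≡ m

a : ℕ → ℕ
a 0 = 0 !
a 1 = 1 !
a 2 = 2 !
a 3 = 3 !
a 4 = 4 !
a (suc (suc (suc (suc (suc k))))) = 6 * 4 ^ (suc (suc (suc (suc (suc k)))) ∸ 3)

numer : ℕ → ℤ
numer 0 = + 1
numer 1 = ℤ.- (+ 3)
numer 2 = ℤ.- (+ 2)
numer 3 = ℤ.- (+ 2)
numer (suc (suc (suc (suc _)))) = + 0

-- Coefficients of the formal power series (1 - 4x) · Σ f(n) xⁿ.
times1-4x : (ℕ → ℕ) → ℕ → ℤ
times1-4x f 0 = + f 0
times1-4x f (suc n) = + f (suc n) ℤ.- (+ 4) ℤ.* (+ f n)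

-- Let σ be the n-permutation left when the maximal entry of an (n+1)-permutation π is
-- deleted. The maximum cannot play any label other than 1, being larger than every entry,
-- and it plays label 1 of an occurrence exactly when at least four entries follow it.
-- Hence π avoids p iff σ avoids p and the maximum is among the last four positions, so
-- a(n+1) = min(4, n+1) · a(n); this gives the closed form, and the recurrence
-- a(n+1) = 4 a(n) for n ≥ 4 makes (1 - 4x) Σ a(n) xⁿ a polynomial of degree 3.
module Submission where

open import Defs
open import Data.Nat using (ℕ; zero; suc; _+_; _*_; _⊓_; _^_; _∸_; _≤_; _<_; s≤s)
import Data.Nat.Properties as ℕ
open import Data.Fin as Fin using (Fin; toℕ; fromℕ; fromℕ<; inject≤; punchIn; punchOut; opposite)
import Data.Fin.Properties as Fin
open import Data.Vec as Vec using (Vec; []; lookup; insertAt; tabulate)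
import Data.Vec.Properties as Vec
open import Data.Vec.Relation.Binary.Pointwise.Extensional using (ext; Pointwise-≡⇒≡)
open import Data.List as List using (List; length; cartesianProductWith)
import Data.List.Properties as List
open import Data.List.Membership.Propositional using (_∈_)
open import Data.List.Membership.Propositional.Properties
  using (∈-tabulate⁺; ∈-tabulate⁻; ∈-cartesianProductWith⁺; ∈-cartesianProductWith⁻)
open import Data.List.Relation.Unary.Any using (here)
open import Data.List.Relation.Unary.All as All using ()
open import Data.List.Relation.Unary.AllPairs as AllPairs using ()
open import Data.List.Relation.Unary.Unique.Propositional using (Unique)
import Data.List.Relation.Unary.Unique.Propositional.Properties as Uniqueₚ
open import Data.Product using (∃; ∃₂; _×_; _,_)
open import Data.Empty using (⊥-elim)
open import Function using (_∘_)
open import Relation.Nullary using (¬_; yes; no)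
open import Relation.Binary.PropositionalEquality
open import Data.Integer as ℤ using (+_)
import Data.Integer.Properties as ℤ

private
  variable
    n : ℕ

punchIn-mono-< : ∀ (i : Fin (suc n)) {j k : Fin n} → j Fin.< k → punchIn i j Fin.< punchIn i k
punchIn-mono-< i {j} {k} j<k = Fin.≤∧≢⇒< (Fin.punchIn-mono-≤ i j k (ℕ.<⇒≤ j<k))
                                 (Fin.<⇒≢ j<k ∘ Fin.punchIn-injective i j k)

punchIn-cancel-< : ∀ (i : Fin (suc n)) {j k : Fin n} → punchIn i j Fin.< punchIn i k → j Fin.< k
punchIn-cancel-< i {j} {k} lt = Fin.≤∧≢⇒< (Fin.punchIn-cancel-≤ i j k (ℕ.<⇒≤ lt))
                                  (λ { refl → ℕ.<-irrefl refl lt })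

fromℕ-≮ : ∀ (i : Fin (suc n)) → ¬ (fromℕ n Fin.< i)
fromℕ-≮ i lt = ℕ.<⇒≱ lt (Fin.≤fromℕ i)

punchIn-fromℕ-< : ∀ (j : Fin n) → punchIn (fromℕ n) j Fin.< fromℕ n
punchIn-fromℕ-< {n} j = Fin.≤∧≢⇒< (Fin.≤fromℕ _) (Fin.punchInᵢ≢i (fromℕ n) j)

<⇒opposite-> : ∀ {i j : Fin n} → i Fin.< j → opposite j Fin.< opposite i
<⇒opposite-> {i = i} {j} i<j =
  subst₂ _<_ (sym (Fin.opposite-prop j)) (sym (Fin.opposite-prop i))
    (ℕ.∸-monoʳ-< (s≤s i<j) (Fin.toℕ<n j))

-- toℕ (opposite i) ≡ n ∸ suc (toℕ i) is the number of positions after i.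
ascending⇒room : ∀ {i₁ i₂ i₃ i₄ i₅ : Fin n} →
  i₁ Fin.< i₂ → i₂ Fin.< i₃ → i₃ Fin.< i₄ → i₄ Fin.< i₅ → 4 ≤ toℕ (opposite i₁)
ascending⇒room {i₅ = i₅} a b c d =
  ℕ.≤-trans (ℕ.m≤m+n 4 (toℕ (opposite i₅)))
    (ℕ.≤-trans (ℕ.+-monoʳ-≤ 3 (<⇒opposite-> d))
      (ℕ.≤-trans (ℕ.+-monoʳ-≤ 2 (<⇒opposite-> c))
        (ℕ.≤-trans (ℕ.+-monoʳ-≤ 1 (<⇒opposite-> b)) (<⇒opposite-> a))))

room⇒later : ∀ {k} (i : Fin n) → suc k ≤ toℕ (opposite i) →
  ∃ λ j → i Fin.< j × k ≤ toℕ (opposite j)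
room⇒later {n} {k} i room = j , i<j , room′
  where
  room-i : suc k ≤ n ∸ suc (toℕ i)
  room-i = subst (suc k ≤_) (Fin.opposite-prop i) room
  bound : suc (toℕ i) < n
  bound = ℕ.m∸n≢0⇒n<m (ℕ.m<n⇒n≢0 room-i)
  j : Fin n
  j = fromℕ< bound
  i<j : i Fin.< j
  i<j = subst (toℕ i <_) (sym (Fin.toℕ-fromℕ< bound)) (ℕ.n<1+n (toℕ i))
  room′ : k ≤ toℕ (opposite j)
  room′ = subst (k ≤_)
    (trans (ℕ.pred[m∸n]≡m∸[1+n] n (suc (toℕ i)))
           (sym (trans (Fin.opposite-prop j) (cong (λ x → n ∸ suc x) (Fin.toℕ-fromℕ< bound)))))
    (ℕ.pred-mono-≤ room-i)

lastPositions : ℕ → (n : ℕ) → List (Fin n)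
lastPositions k n = List.tabulate (λ (j : Fin (k ⊓ n)) → opposite (inject≤ j (ℕ.m⊓n≤n k n)))

length-lastPositions : ∀ k n → length (lastPositions k n) ≡ k ⊓ n
length-lastPositions k n = List.length-tabulate _

lastPositions-unique : ∀ k n → Unique (lastPositions k n)
lastPositions-unique k n = Uniqueₚ.tabulate⁺ (Fin.inject≤-injective _ _ _ _ ∘ opposite-injective)
  where
  opposite-injective : ∀ {i j : Fin n} → opposite i ≡ opposite j → i ≡ j
  opposite-injective {i} {j} eq =
    trans (sym (Fin.opposite-involutive i)) (trans (cong opposite eq) (Fin.opposite-involutive j))

∈-lastPositions⁺ : ∀ {k} {p : Fin n} → toℕ (opposite p) < k → p ∈ lastPositions k n
∈-lastPositions⁺ {n} {k} {p} lt = subst (_∈ lastPositions k n) eq (∈-tabulate⁺ (fromℕ< lt′))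
  where
  lt′ : toℕ (opposite p) < k ⊓ n
  lt′ = ℕ.⊓-pres-m< lt (Fin.toℕ<n (opposite p))
  eq : opposite (inject≤ (fromℕ< lt′) (ℕ.m⊓n≤n k n)) ≡ p
  eq = trans (cong opposite (Fin.toℕ-injective
                (trans (Fin.toℕ-inject≤ _ _) (Fin.toℕ-fromℕ< lt′))))
             (Fin.opposite-involutive p)

∈-lastPositions⁻ : ∀ {k} {p : Fin n} → p ∈ lastPositions k n → toℕ (opposite p) < k
∈-lastPositions⁻ {n} {k} mem with j , refl ← ∈-tabulate⁻ mem =
  subst (_< k) (sym (trans (cong toℕ (Fin.opposite-involutive _)) (Fin.toℕ-inject≤ j _)))
    (ℕ.m<n⊓o⇒m<n k n (Fin.toℕ<n j))

module _ {m} {σ : Vec (Fin m) m} {π : Vec (Fin n) n} (f : Fin m → Fin n) where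

  occurrence-map : (∀ {j k} → j Fin.< k → f j Fin.< f k) →
    (∀ {j k} → lookup σ j Fin.< lookup σ k → lookup π (f j) Fin.< lookup π (f k)) →
    ∀ {j₁ j₂ j₃ j₄ j₅} → Occurrence σ j₁ j₂ j₃ j₄ j₅ →
    Occurrence π (f j₁) (f j₂) (f j₃) (f j₄) (f j₅)
  occurrence-map pos val (a , b , c , d , v₂ , v₃ , v₄ , v₅) =
    pos a , pos b , pos c , pos d , val v₂ , val v₃ , val v₄ , val v₅

  occurrence-comap : (∀ {j k} → f j Fin.< f k → j Fin.< k) →
    (∀ {j k} → lookup π (f j) Fin.< lookup π (f k) → lookup σ j Fin.< lookup σ k) →
    ∀ {j₁ j₂ j₃ j₄ j₅} → Occurrence π (f j₁) (f j₂) (f j₃) (f j₄) (f j₅) →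
    Occurrence σ j₁ j₂ j₃ j₄ j₅
  occurrence-comap pos val (a , b , c , d , v₂ , v₃ , v₄ , v₅) =
    pos a , pos b , pos c , pos d , val v₂ , val v₃ , val v₄ , val v₅

insertMax : Fin (suc n) → Vec (Fin n) n → Vec (Fin (suc n)) (suc n)
insertMax {n} p σ = insertAt (Vec.map (punchIn (fromℕ n)) σ) p (fromℕ n)

data PunchInView (p : Fin (suc n)) : Fin (suc n) → Set where
  at        : PunchInView p p
  punchedIn : (j : Fin n) → PunchInView p (punchIn p j)

punchInView : (p i : Fin (suc n)) → PunchInView p i
punchInView p i with p Fin.≟ i
... | yes refl = at
... | no p≢i   = subst (PunchInView p) (Fin.punchIn-punchOut p≢i) (punchedIn (punchOut p≢i))

module _ (p : Fin (suc n)) (σ : Vec (Fin n) n) where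

  private
    π = insertMax p σ

  insertMax-at : lookup π p ≡ fromℕ n
  insertMax-at = Vec.insertAt-lookup _ p (fromℕ n)

  insertMax-punchIn : ∀ j → lookup π (punchIn p j) ≡ punchIn (fromℕ n) (lookup σ j)
  insertMax-punchIn j = trans (Vec.insertAt-punchIn _ p (fromℕ n) j) (Vec.lookup-map j _ σ)

  insertMax-punchIn≢max : ∀ j → lookup π (punchIn p j) ≢ fromℕ n
  insertMax-punchIn≢max j eq =
    Fin.punchInᵢ≢i (fromℕ n) (lookup σ j) (trans (sym (insertMax-punchIn j)) eq)

  insertMax-at-unique : ∀ q → lookup π q ≡ fromℕ n → q ≡ p
  insertMax-at-unique q eq with punchInView p q
  ... | at          = refl
  ... | punchedIn j = ⊥-elim (insertMax-punchIn≢max j eq)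

  insertMax-<-at : ∀ {q} → p Fin.< q → lookup π q Fin.< lookup π p
  insertMax-<-at {q} p<q with punchInView p q
  ... | at          = ⊥-elim (ℕ.<-irrefl refl p<q)
  ... | punchedIn j =
    subst₂ Fin._<_ (sym (insertMax-punchIn j)) (sym insertMax-at) (punchIn-fromℕ-< (lookup σ j))

  insertMax-≮-at : ∀ q → ¬ (lookup π p Fin.< lookup π q)
  insertMax-≮-at q lt = fromℕ-≮ (lookup π q) (subst (Fin._< lookup π q) insertMax-at lt)

  insertMax-mono-< : ∀ {j k} → lookup σ j Fin.< lookup σ k →
                     lookup π (punchIn p j) Fin.< lookup π (punchIn p k)
  insertMax-mono-< {j} {k} lt = subst₂ Fin._<_ (sym (insertMax-punchIn j)) (sym (insertMax-punchIn k))
                                  (punchIn-mono-< (fromℕ n) lt)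

  insertMax-cancel-< : ∀ {j k} → lookup π (punchIn p j) Fin.< lookup π (punchIn p k) →
                       lookup σ j Fin.< lookup σ k
  insertMax-cancel-< {j} {k} lt = punchIn-cancel-< (fromℕ n)
    (subst₂ Fin._<_ (insertMax-punchIn j) (insertMax-punchIn k) lt)

  insertMax-isPerm⁺ : IsPerm n σ → IsPerm (suc n) π
  insertMax-isPerm⁺ σ-inj {x} {y} = go (punchInView p x) (punchInView p y)
    where
    go : ∀ {x y} → PunchInView p x → PunchInView p y → lookup π x ≡ lookup π y → x ≡ y
    go at            at            _  = refl
    go at            (punchedIn k) eq = ⊥-elim (insertMax-punchIn≢max k (trans (sym eq) insertMax-at))
    go (punchedIn j) at            eq = ⊥-elim (insertMax-punchIn≢max j (trans eq insertMax-at))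
    go (punchedIn j) (punchedIn k) eq = cong (punchIn p) (σ-inj (Fin.punchIn-injective (fromℕ n) _ _
      (trans (sym (insertMax-punchIn j)) (trans eq (insertMax-punchIn k)))))

  insertMax-isPerm⁻ : IsPerm (suc n) π → IsPerm n σ
  insertMax-isPerm⁻ π-inj {j} {k} eq = Fin.punchIn-injective p j k (π-inj
    (trans (insertMax-punchIn j) (trans (cong (punchIn (fromℕ n)) eq) (sym (insertMax-punchIn k)))))

  insertMax-avoids⁺ : toℕ (opposite p) < 4 → Avoids σ → Avoids π
  insertMax-avoids⁺ near σ-av (i₁ , i₂ , i₃ , i₄ , i₅ , occ) =
    go (punchInView p i₁) (punchInView p i₂) (punchInView p i₃) (punchInView p i₄) (punchInView p i₅)
       occ
    where
    go : ∀ {i₁ i₂ i₃ i₄ i₅} → PunchInView p i₁ → PunchInView p i₂ → PunchInView p i₃ →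
         PunchInView p i₄ → PunchInView p i₅ → ¬ Occurrence π i₁ i₂ i₃ i₄ i₅
    go at _ _ _ _ (a , b , c , d , _) = ℕ.<⇒≱ near (ascending⇒room a b c d)
    go (punchedIn _) at _ _ _ (_ , _ , _ , _ , v , _) = insertMax-≮-at _ v
    go (punchedIn _) (punchedIn _) at _ _ (_ , _ , _ , _ , _ , v , _) = insertMax-≮-at _ v
    go (punchedIn _) (punchedIn _) (punchedIn _) at _ (_ , _ , _ , _ , _ , _ , v , _) =
      insertMax-≮-at _ v
    go (punchedIn _) (punchedIn _) (punchedIn _) (punchedIn _) at (_ , _ , _ , _ , _ , _ , _ , v) =
      insertMax-≮-at _ v
    go (punchedIn j₁) (punchedIn j₂) (punchedIn j₃) (punchedIn j₄) (punchedIn j₅) occ =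
      σ-av (j₁ , j₂ , j₃ , j₄ , j₅ ,
            occurrence-comap {σ = σ} {π = π} (punchIn p) (punchIn-cancel-< p) insertMax-cancel-< occ)

  insertMax-avoids⁻ : Avoids π → Avoids σ
  insertMax-avoids⁻ π-av (_ , _ , _ , _ , _ , occ) =
    π-av (_ , _ , _ , _ , _ ,
          occurrence-map {σ = σ} {π = π} (punchIn p) (punchIn-mono-< p) insertMax-mono-< occ)

  insertMax-room-occurrence : 4 ≤ toℕ (opposite p) → ¬ Avoids π
  insertMax-room-occurrence room π-av
    with q₁ , p<q₁  , room₁ ← room⇒later p room
    with q₂ , q₁<q₂ , room₂ ← room⇒later q₁ room₁
    with q₃ , q₂<q₃ , room₃ ← room⇒later q₂ room₂
    with q₄ , q₃<q₄ , _     ← room⇒later q₃ room₃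
    = π-av (p , q₁ , q₂ , q₃ , q₄ , p<q₁ , q₁<q₂ , q₂<q₃ , q₃<q₄ ,
            insertMax-<-at p<q₁ , insertMax-<-at p<q₂ , insertMax-<-at p<q₃ ,
            insertMax-<-at (Fin.<-trans p<q₃ q₃<q₄))
    where
    p<q₂ : p Fin.< q₂
    p<q₂ = Fin.<-trans p<q₁ q₁<q₂
    p<q₃ : p Fin.< q₃
    p<q₃ = Fin.<-trans p<q₂ q₂<q₃

  insertMax-avoids⇒near : Avoids π → toℕ (opposite p) < 4
  insertMax-avoids⇒near π-av = ℕ.≰⇒> (λ room → insertMax-room-occurrence room π-av)

insertMax-injectiveˡ : ∀ {p p′ : Fin (suc n)} {σ σ′} →
                       insertMax p σ ≡ insertMax p′ σ′ → p ≡ p′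
insertMax-injectiveˡ {p = p} {p′} {σ} {σ′} eq =
  insertMax-at-unique p′ σ′ p (trans (cong (λ v → lookup v p) (sym eq)) (insertMax-at p σ))

insertMax-injectiveʳ : ∀ {p : Fin (suc n)} {σ σ′} → insertMax p σ ≡ insertMax p σ′ → σ ≡ σ′
insertMax-injectiveʳ {n} {p} {σ} {σ′} eq =
  Pointwise-≡⇒≡ (ext λ j → Fin.punchIn-injective (fromℕ n) _ _ (begin
    punchIn (fromℕ n) (lookup σ j)        ≡⟨ insertMax-punchIn p σ j ⟨
    lookup (insertMax p σ) (punchIn p j)  ≡⟨ cong (λ v → lookup v (punchIn p j)) eq ⟩
    lookup (insertMax p σ′) (punchIn p j) ≡⟨ insertMax-punchIn p σ′ j ⟩
    punchIn (fromℕ n) (lookup σ′ j)       ∎))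
  where open ≡-Reasoning

insertMax-injective : ∀ {p p′ : Fin (suc n)} {σ σ′} →
                      insertMax p σ ≡ insertMax p′ σ′ → p ≡ p′ × σ ≡ σ′
insertMax-injective eq with refl ← insertMax-injectiveˡ eq = refl , insertMax-injectiveʳ eq

insertMax-surjective : ∀ (π : Vec (Fin (suc n)) (suc n)) → IsPerm (suc n) π →
                       ∃₂ λ p σ → insertMax p σ ≡ π
insertMax-surjective {n} π π-inj
  with p , _ , max≤ ← Fin.injective⇒existsPivot π-inj (fromℕ n)
  = p , σ , Pointwise-≡⇒≡ (ext agree)
  where
  max-at-p : lookup π p ≡ fromℕ n
  max-at-p = Fin.≤-antisym (Fin.≤fromℕ _) max≤
  max≢ : ∀ j → fromℕ n ≢ lookup π (punchIn p j)
  max≢ j eq = Fin.punchInᵢ≢i p j (π-inj (trans (sym eq) (sym max-at-p)))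
  σ : Vec (Fin n) n
  σ = tabulate (λ j → punchOut (max≢ j))
  agree : ∀ i → lookup (insertMax p σ) i ≡ lookup π i
  agree i with punchInView p i
  ... | at          = trans (insertMax-at p σ) (sym max-at-p)
  ... | punchedIn j = begin
    lookup (insertMax p σ) (punchIn p j)  ≡⟨ insertMax-punchIn p σ j ⟩
    punchIn (fromℕ n) (lookup σ j)        ≡⟨ cong (punchIn (fromℕ n)) (Vec.lookup∘tabulate _ j) ⟩
    punchIn (fromℕ n) (punchOut (max≢ j)) ≡⟨ Fin.punchIn-punchOut (max≢ j) ⟩
    lookup π (punchIn p j)                ∎
    where open ≡-Reasoning

avoiders : ∀ n → List (Vec (Fin n) n)
avoiders zero    = [] List.∷ List.[]
avoiders (suc n) = cartesianProductWith insertMax (lastPositions 4 (suc n)) (avoiders n)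

avoiders-sound : ∀ n (π : Vec (Fin n) n) → π ∈ avoiders n → IsPerm n π × Avoids π
avoiders-sound zero [] _ = (λ { {()} }) , λ { (() , _) }
avoiders-sound (suc n) π mem
  with p , σ , p-near , σ-mem , refl ←
         ∈-cartesianProductWith⁻ insertMax (lastPositions 4 (suc n)) (avoiders n) mem
  with σ-perm , σ-av ← avoiders-sound n σ σ-mem
  = insertMax-isPerm⁺ p σ σ-perm , insertMax-avoids⁺ p σ (∈-lastPositions⁻ p-near) σ-av

avoiders-complete : ∀ n (π : Vec (Fin n) n) → IsPerm n π → Avoids π → π ∈ avoiders n
avoiders-complete zero [] _ _ = here refl
avoiders-complete (suc n) π π-perm π-av
  with p , σ , refl ← insertMax-surjective π π-perm
  = ∈-cartesianProductWith⁺ insertMax (∈-lastPositions⁺ (insertMax-avoids⇒near p σ π-av))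
      (avoiders-complete n σ (insertMax-isPerm⁻ p σ π-perm) (insertMax-avoids⁻ p σ π-av))

avoiders-unique : ∀ n → Unique (avoiders n)
avoiders-unique zero    = All.[] AllPairs.∷ AllPairs.[]
avoiders-unique (suc n) = Uniqueₚ.cartesianProductWith⁺ insertMax insertMax-injective
  (lastPositions-unique 4 (suc n)) (avoiders-unique n)

length-cartesianProductWith : ∀ {A B C : Set} (f : A → B → C) (xs : List A) (ys : List B) →
  length (cartesianProductWith f xs ys) ≡ length xs * length ys
length-cartesianProductWith f List.[]        ys = refl
length-cartesianProductWith f (x List.∷ xs) ys = trans (List.length-++ (List.map (f x) ys))
  (cong₂ _+_ (List.length-map (f x) ys) (length-cartesianProductWith f xs ys))

a-suc : ∀ n → a (suc n) ≡ (4 ⊓ suc n) * a n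
a-suc 0 = refl
a-suc 1 = refl
a-suc 2 = refl
a-suc 3 = refl
a-suc 4 = refl
a-suc (suc (suc (suc (suc (suc k))))) = begin
  6 * (4 * 4 ^ (2 + k)) ≡⟨ ℕ.*-assoc 6 4 (4 ^ (2 + k)) ⟨
  (6 * 4) * 4 ^ (2 + k) ≡⟨ cong (_* 4 ^ (2 + k)) (ℕ.*-comm 6 4) ⟩
  (4 * 6) * 4 ^ (2 + k) ≡⟨ ℕ.*-assoc 4 6 (4 ^ (2 + k)) ⟩
  4 * (6 * 4 ^ (2 + k)) ∎
  where open ≡-Reasoning

length-avoiders : ∀ n → length (avoiders n) ≡ a n
length-avoiders zero    = refl
length-avoiders (suc n) = begin
  length (avoiders (suc n))
    ≡⟨ length-cartesianProductWith insertMax (lastPositions 4 (suc n)) (avoiders n) ⟩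
  length (lastPositions 4 (suc n)) * length (avoiders n)
    ≡⟨ cong₂ _*_ (length-lastPositions 4 (suc n)) (length-avoiders n) ⟩
  (4 ⊓ suc n) * a n
    ≡⟨ a-suc n ⟨
  a (suc n)
    ∎
  where open ≡-Reasoning

times1-4x-a : ∀ n → times1-4x a n ≡ numer n
times1-4x-a 0 = refl
times1-4x-a 1 = refl
times1-4x-a 2 = refl
times1-4x-a 3 = refl
times1-4x-a 4 = refl
times1-4x-a (suc (suc (suc (suc (suc k))))) = begin
  + a (5 + k) ℤ.- + 4 ℤ.* + y   ≡⟨ cong (λ x → + x ℤ.- + 4 ℤ.* + y) (a-suc (4 + k)) ⟩
  + (4 * y) ℤ.- + 4 ℤ.* + y     ≡⟨ cong (λ x → + (4 * y) ℤ.- x) (ℤ.pos-* 4 y) ⟨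
  + (4 * y) ℤ.- + (4 * y)       ≡⟨ ℤ.+-inverseʳ (+ (4 * y)) ⟩
  + 0                           ∎
  where
  open ≡-Reasoning
  y : ℕ
  y = a (4 + k)

theorem33 : ((n : ℕ) → AvoidersCount n (a n)) × ((n : ℕ) → times1-4x a n ≡ numer n)
theorem33 = count , times1-4x-a
  where
  count : ∀ n → AvoidersCount n (a n)
  count n = avoiders n , avoiders-unique n , avoiders-sound n , avoiders-complete n , length-avoiders n
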